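{- Let $a>1$ be odd. If for some integers $1\leq r<k$ we have $x_{2^r}^{(a)}=2^k+2^r$, then there exists $T\ge 0$ such that $x_{2^T}^{(a)}=3\cdot 2^T$.
   Context: For a positive integer $m$, let $\nu_2(m)$ be the exponent of the highest power of $2$ dividing $m$. For an odd integer $a>1$, define $x_1^{(a)}=a$ and, for $n\ge2$, $x_n^{(a)}$ is the smallest integer $y>x_{n-1}^{(a)}$ with $\nu_2(y)=\nu_2(n)$. -}

module Defs where

open import Data.Nat using (ℕ; zero; suc; _+_; _*_; _^_; _<_; _≤_)
open import Data.Nat.Divisibility using (_∣_)
open import Relation.Binary.PropositionalEquality using (_≡_)
open import Relation.Nullary using (¬_)
open import Data.Product using (_×_)

-- 2-adic valuation: ν₂ m = v  iff  2^v ∣ m  and  ¬ 2^(v+1) ∣ m.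
-- (Stated as a relation; it only holds for m > 0.)
Val2 : ℕ → ℕ → Set
Val2 m v = (2 ^ v ∣ m) × ¬ (2 ^ suc v ∣ m)

-- X a n y  :  x_n^{(a)} = y.
-- x_1 = a ; x_{n+1} is the smallest y > x_n with ν₂(y) = ν₂(n+1).
data X (a : ℕ) : ℕ → ℕ → Set where
  x-one  : X a 1 a
  x-step : ∀ {n p y} → X a (suc n) p →
           p < y →
           (∀ v → Val2 y v → Val2 (suc (suc n)) v) →
           (∀ z → p < z → z < y → ∀ v → Val2 z v → ¬ Val2 (suc (suc n)) v) →
           X a (suc (suc n)) y

{-# OPTIONS --safe #-}
module Submission where

-- Adding 2^k to a positive n < 2^k does not change its 2-adic valuation, so
-- once x_n = 2^k + n the next term is the very next integer 2^k + n + 1, and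
-- this persists up to x_(2^k - 1) = 2^(k+1) - 1.  Then x_(2^k) is the first
-- integer beyond that with valuation k: 2^(k+1) has valuation k + 1, and the
-- next multiple of 2^k is 3 * 2^k.

open import Defs
open import Data.Nat
  using (ℕ; zero; suc; pred; _+_; _*_; _^_; _<_; _≤_; _≤′_; ≤′-refl; ≤′-step; s≤s⁻¹; NonZero)
open import Data.Nat.Properties
open import Data.Nat.Divisibility
  using (_∣_; divides; ∣-refl; ∣-trans; ∣m+n∣m⇒∣n; ∣m∣n⇒∣m+n; m∣m*n; n∣m*n; *-cancelʳ-∣; >⇒∤)
open import Data.Product using (∃-syntax; _,_)
open import Relation.Nullary using (¬_)
open import Relation.Binary.PropositionalEquality using (_≡_; refl; sym; cong; subst; module ≡-Reasoning)
open import Function using (id)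

2^-mono-∣ : ∀ {i j} → i ≤ j → 2 ^ i ∣ 2 ^ j
2^-mono-∣ {i} i≤j with m≤n⇒∃[o]m+o≡n i≤j
... | o , refl = subst (2 ^ i ∣_) (sym (^-distribˡ-+-* 2 i o)) (m∣m*n (2 ^ o))

2^-mono-< : ∀ {i j} → i < j → 2 ^ i < 2 ^ j
2^-mono-< = ^-monoʳ-< 2 (≤-refl {2})

Val2⇒≤ : ∀ m v w → Val2 m v → 2 ^ w ∣ m → w ≤ v
Val2⇒≤ _ _ _ (_ , 2^[1+v]∤m) 2^w∣m = ≮⇒≥ λ v<w → 2^[1+v]∤m (∣-trans (2^-mono-∣ v<w) 2^w∣m)

Val2-unique : ∀ m v w → Val2 m v → Val2 m w → v ≡ w
Val2-unique m v w val@(2^v∣m , _) val′@(2^w∣m , _) =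
  ≤-antisym (Val2⇒≤ m w v val′ 2^v∣m) (Val2⇒≤ m v w val 2^w∣m)

Val2-2^ : ∀ k → Val2 (2 ^ k) k
Val2-2^ k = ∣-refl , >⇒∤ {{m^n≢0 2 k}} (2^-mono-< (n<1+n k))

Val2-odd*2^ : ∀ {q} k → ¬ 2 ∣ q → Val2 (q * 2 ^ k) k
Val2-odd*2^ {q} k 2∤q =
  n∣m*n q , λ 2*2^k∣q*2^k → 2∤q (*-cancelʳ-∣ (2 ^ k) {{m^n≢0 2 k}} 2*2^k∣q*2^k)

2∤3 : ¬ 2 ∣ 3
2∤3 (divides (suc (suc zero)) ())

Val2[2^k+m]⇒Val2[m] : ∀ k {m} v .{{_ : NonZero m}} → m < 2 ^ k → Val2 (2 ^ k + m) v → Val2 m v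
Val2[2^k+m]⇒Val2[m] k {m} v m<2^k (2^v∣ , 2^[1+v]∤) =
  ∣m+n∣m⇒∣n 2^v∣ (2^-mono-∣ (<⇒≤ v<k)) ,
  λ 2^[1+v]∣m → 2^[1+v]∤ (∣m∣n⇒∣m+n (2^-mono-∣ v<k) 2^[1+v]∣m)
  where
  v<k : v < k
  v<k = ≰⇒> λ k≤v → >⇒∤ m<2^k (∣m+n∣m⇒∣n (∣-trans (2^-mono-∣ k≤v) 2^v∣) ∣-refl)

-- The only multiple of 2^k in [2 * 2^k, 3 * 2^k) is 2^(k+1).
¬Val2-between : ∀ k {z} → 2 * 2 ^ k ≤ z → z < 3 * 2 ^ k → ¬ Val2 z k
¬Val2-between k lo hi (divides q refl , 2^[1+k]∤) =
  2^[1+k]∤ (subst (λ c → 2 ^ suc k ∣ c * 2 ^ k) (sym q≡2) ∣-refl)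
  where
  q≡2 : q ≡ 2
  q≡2 = ≤-antisym (s≤s⁻¹ (*-cancelʳ-< _ q 3 hi)) (*-cancelʳ-≤ 2 q (2 ^ k) {{m^n≢0 2 k}} lo)

module _ {a : ℕ} where

  open ≡-Reasoning

  X-suc : ∀ {m p y} → 1 ≤ m → X a m p → p < y →
          (∀ v → Val2 y v → Val2 (suc m) v) →
          (∀ z → p < z → z < y → ∀ v → Val2 z v → ¬ Val2 (suc m) v) →
          X a (suc m) y
  X-suc {suc _} _ = x-step

  X-suc-offset : ∀ {c m} → 1 ≤ m → X a m (c + m) →
                 (∀ v → Val2 (c + suc m) v → Val2 (suc m) v) →
                 X a (suc m) (c + suc m)
  X-suc-offset {c} {m} 1≤m x val =
    X-suc 1≤m x (+-monoʳ-< c (n<1+n m)) val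
      λ z c+m<z z<c+1+m _ _ _ → <⇒≱ c+m<z (s≤s⁻¹ (subst (z <_) (+-suc c m) z<c+1+m))

  X-2^+-run : ∀ k {n m} → 1 ≤ n → n ≤ m → m < 2 ^ k → X a n (2 ^ k + n) → X a m (2 ^ k + m)
  X-2^+-run k {n} 1≤n n≤m = go (≤⇒≤′ n≤m)
    where
    go : ∀ {m} → n ≤′ m → m < 2 ^ k → X a n (2 ^ k + n) → X a m (2 ^ k + m)
    go ≤′-refl _ x = x
    go (≤′-step n≤′m) 1+m<2^k x =
      X-suc-offset (≤-trans 1≤n (≤′⇒≤ n≤′m)) (go n≤′m (<⇒≤ 1+m<2^k) x)
        λ v → Val2[2^k+m]⇒Val2[m] k v 1+m<2^k

  X-2^-after-run : ∀ k {m} → 1 ≤ m → suc m ≡ 2 ^ k → X a m (2 ^ k + m) → X a (2 ^ k) (3 * 2 ^ k)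
  X-2^-after-run k {m} 1≤m 1+m≡2^k x =
    subst (λ n → X a n (3 * 2 ^ k)) 1+m≡2^k
      (X-suc 1≤m x 2^k+m<3*2^k Val2[3*2^k]⇒Val2[1+m] no-earlier-candidate)
    where
    Val2[1+m] : ∀ v → Val2 (suc m) v ≡ Val2 (2 ^ k) v
    Val2[1+m] v = cong (λ n → Val2 n v) 1+m≡2^k

    1+[2^k+m]≡2*2^k : suc (2 ^ k + m) ≡ 2 * 2 ^ k
    1+[2^k+m]≡2*2^k = begin
      suc (2 ^ k + m)    ≡⟨ +-suc (2 ^ k) m ⟨
      2 ^ k + suc m      ≡⟨ cong (2 ^ k +_) 1+m≡2^k ⟩
      2 ^ k + 2 ^ k      ≡⟨ cong (2 ^ k +_) (+-identityʳ (2 ^ k)) ⟨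
      2 * 2 ^ k          ∎

    2^k+m<3*2^k : 2 ^ k + m < 3 * 2 ^ k
    2^k+m<3*2^k = subst (_≤ 3 * 2 ^ k) (sym 1+[2^k+m]≡2*2^k) (m≤n+m (2 * 2 ^ k) (2 ^ k))

    Val2[3*2^k]⇒Val2[1+m] : ∀ v → Val2 (3 * 2 ^ k) v → Val2 (suc m) v
    Val2[3*2^k]⇒Val2[1+m] v val = subst (λ w → Val2 (suc m) w)
      (Val2-unique (3 * 2 ^ k) k v (Val2-odd*2^ k 2∤3) val)
      (subst id (sym (Val2[1+m] k)) (Val2-2^ k))

    no-earlier-candidate : ∀ z → 2 ^ k + m < z → z < 3 * 2 ^ k → ∀ v → Val2 z v → ¬ Val2 (suc m) v
    no-earlier-candidate z 2^k+m<z z<3*2^k v val-z val-1+m =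
      ¬Val2-between k (subst (_≤ z) 1+[2^k+m]≡2*2^k 2^k+m<z) z<3*2^k (subst (Val2 z) v≡k val-z)
      where
      v≡k : v ≡ k
      v≡k = Val2-unique (2 ^ k) v k (subst id (Val2[1+m] v) val-1+m) (Val2-2^ k)

lemma2 : (a : ℕ) → 1 < a → ¬ (2 ∣ a) →
         (r k : ℕ) → 1 ≤ r → r < k →
         X a (2 ^ r) (2 ^ k + 2 ^ r) →
         ∃[ T ] X a (2 ^ T) (3 * 2 ^ T)
lemma2 a _ _ r k _ r<k x[2^r] = k , X-2^-after-run k 1≤pred[2^k] (suc-pred (2 ^ k)) x[pred[2^k]]
  where
  instance
    2^k≢0 : NonZero (2 ^ k)
    2^k≢0 = m^n≢0 2 k
  1≤2^r : 1 ≤ 2 ^ r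
  1≤2^r = m^n>0 2 r
  2^r≤pred[2^k] : 2 ^ r ≤ pred (2 ^ k)
  2^r≤pred[2^k] = <⇒≤pred (2^-mono-< r<k)
  1≤pred[2^k] : 1 ≤ pred (2 ^ k)
  1≤pred[2^k] = ≤-trans 1≤2^r 2^r≤pred[2^k]
  x[pred[2^k]] : X a (pred (2 ^ k)) (2 ^ k + pred (2 ^ k))
  x[pred[2^k]] = X-2^+-run k 1≤2^r 2^r≤pred[2^k] (≤-reflexive (suc-pred (2 ^ k))) x[2^r]
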